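{- Let $n\ge1$ and let $(h_{i,j},v_{i,j},d_{i,j})_{1\le i,j\le n}$ be an $n\times n$ Alternating Phase Matrix of type 1, 2 or 3, and set $a_{i,j}=-\omega h_{i,j}+\omega^2v_{i,j}$ with $\omega=e^{2\pi i/3}$. Then $\sum_{i,j=1}^na_{i,j}=n$.
   Context: An $n\times n$ Alternating Phase Matrix (APM) of type 1, 2 or 3 is an $n\times n$ array of triples $(h_{i,j},v_{i,j},d_{i,j})$ with $h_{i,j},v_{i,j},d_{i,j}\in\{0,1,-1\}$ and $h_{i,j}+v_{i,j}+d_{i,j}=0$, such that: (1) each row $i$ contains at least one nonzero $h_{i,j}$ and each column $j$ at least one nonzero $v_{i,j}$; (2) in each row, the nonzero $h_{i,j}$, read for $j=1,\dots,n$, alternate $1,-1,1,\dots,1$ (starting and ending with $1$); (3) in each column, the nonzero $v_{i,j}$, read for $i=1,\dots,n$, alternate $-1,1,-1,\dots,-1$ (starting and ending with $-1$); and, for each diagonal $\ell\in[1-n,n-1]$ with entries $d_{i,i+\ell}$ read for $i$ from $\max(1,1-\ell)$ to $\min(n,n-\ell)$, the nonzero entries alternate: type 1: as $-1,1,\dots,1$ if $\ell>0$ and as $1,-1,\dots,-1$ if $\ell\le0$; type 2: as $-1,1,\dots,1$ if $\ell\ge0$ and as $1,-1,\dots,-1$ if $\ell<0$; type 3: as $-1,1,\dots,1$ for all $\ell$. -}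

module Defs where

open import Data.Nat using (ℕ)
open import Data.Fin using (Fin; toℕ)
open import Data.Integer using (ℤ; +_; -_; _+_; _-_; _*_; _<_; _≤_; 0ℤ; 1ℤ; -1ℤ)
import Data.Integer as ℤ
open import Data.List using (List; []; _∷_; map; filter; concatMap; foldr)
open import Data.List using () renaming (allFin to allFinL)
open import Data.Product using (Σ; _×_; _,_)
open import Data.Sum using (_⊎_)
open import Relation.Binary.PropositionalEquality using (_≡_)
open import Relation.Nullary.Decidable using (¬?)

data AltPairs (a b : ℤ) : List ℤ → Set where
  nil  : AltPairs a b []
  cons : ∀ {l} → AltPairs a b l → AltPairs a b (a ∷ b ∷ l)

nonzeros : List ℤ → List ℤ
nonzeros = filter (λ x → ¬? (x ℤ.≟ 0ℤ))

RowAlt : List ℤ → Set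
RowAlt L = Σ (List ℤ) λ l → (nonzeros L ≡ 1ℤ ∷ l) × AltPairs -1ℤ 1ℤ l

ColAlt : List ℤ → Set
ColAlt L = Σ (List ℤ) λ l → (nonzeros L ≡ -1ℤ ∷ l) × AltPairs 1ℤ -1ℤ l

DiagNegFirst : List ℤ → Set
DiagNegFirst L = AltPairs -1ℤ 1ℤ (nonzeros L)

DiagPosFirst : List ℤ → Set
DiagPosFirst L = AltPairs 1ℤ -1ℤ (nonzeros L)

-- Matrices, rows, columns, diagonals (indices 0..n-1 instead of 1..n)

Mat : ℕ → Set
Mat n = Fin n → Fin n → ℤ

row : ∀ {n} → Mat n → Fin n → List ℤ
row M i = map (λ j → M i j) (allFinL _)

col : ∀ {n} → Mat n → Fin n → List ℤ
col M j = map (λ i → M i j) (allFinL _)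

diagPositions : ∀ n → ℤ → List (Fin n × Fin n)
diagPositions n ℓ =
  concatMap (λ i → map (λ j → (i , j))
    (filter (λ j → (+ toℕ j) ℤ.≟ ((+ toℕ i) + ℓ)) (allFinL n)))
    (allFinL n)

diag : ∀ {n} → Mat n → ℤ → List ℤ
diag {n} M ℓ = map (λ { (i , j) → M i j }) (diagPositions n ℓ)

data APMType : Set where
  type1 type2 type3 : APMType

DiagCond : APMType → ℤ → List ℤ → Set
DiagCond type1 ℓ L = (0ℤ < ℓ → DiagNegFirst L) × (ℓ ≤ 0ℤ → DiagPosFirst L)
DiagCond type2 ℓ L = (0ℤ ≤ ℓ → DiagNegFirst L) × (ℓ < 0ℤ → DiagPosFirst L)
DiagCond type3 ℓ L = DiagNegFirst L

Trit : ℤ → Set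
Trit x = (x ≡ 0ℤ) ⊎ ((x ≡ 1ℤ) ⊎ (x ≡ -1ℤ))

record IsAPM (t : APMType) (n : ℕ) (h v d : Mat n) : Set where
  field
    h-trit : ∀ i j → Trit (h i j)
    v-trit : ∀ i j → Trit (v i j)
    d-trit : ∀ i j → Trit (d i j)
    sum0   : ∀ i j → h i j + v i j + d i j ≡ 0ℤ
    rows   : ∀ i → RowAlt (row h i)
    cols   : ∀ j → ColAlt (col v j)
    diags  : ∀ ℓ → DiagCond t ℓ (diag d ℓ)

-- Eisenstein integers ℤ[ω] ⊂ ℂ, ω = e^{2πi/3}, ω² = -1 - ω.
-- mkE a b represents a + b ω  (a unique representation since 1, ω are
-- linearly independent over ℚ).

record Eis : Set where
  constructor mkE
  field
    re : ℤ
    om : ℤ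

_+E_ : Eis → Eis → Eis
mkE a b +E mkE c d = mkE (a + c) (b + d)

-- (a + bω)(c + dω) = ac + (ad + bc) ω + bd ω² = (ac - bd) + (ad + bc - bd) ω
_*E_ : Eis → Eis → Eis
mkE a b *E mkE c d = mkE (a * c - b * d) (a * d + b * c - b * d)

-E_ : Eis → Eis
-E (mkE a b) = mkE (- a) (- b)

ω : Eis
ω = mkE 0ℤ 1ℤ

fromℤ : ℤ → Eis
fromℤ x = mkE x 0ℤ

0E : Eis
0E = mkE 0ℤ 0ℤ

aEntry : ℤ → ℤ → Eis
aEntry hij vij = (-E (ω *E fromℤ hij)) +E ((ω *E ω) *E fromℤ vij)

totalA : ∀ {n} → Mat n → Mat n → Eis
totalA {n} h v =
  foldr _+E_ 0E
    (concatMap (λ i → map (λ j → aEntry (h i j) (v i j)) (allFinL n)) (allFinL n))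

-- Since ω² = -1 - ω, the entry a = -ω h + ω² v equals -v + ω (-h - v).
-- The nonzero entries of a row of h alternate 1, -1, …, 1, so every row of h
-- sums to 1; likewise every column of v sums to -1.  Hence Σ h = n and
-- Σ v = -n, and Σ a = n + ω (-n + n) = n.
module Submission where

open import Defs
open import Data.Nat using (ℕ; _≤_; zero; suc)
open import Data.Integer using (ℤ; +_; -_; _+_; 0ℤ; 1ℤ; -1ℤ)
import Data.Integer as ℤ
open import Data.Integer.Properties
  using (+-0-commutativeMonoid; +-identityˡ; +-identityʳ; +-assoc; +-inverseʳ; neg-distrib-+; neg-involutive)
open import Data.Integer.Tactic.RingSolver using (solve-∀)
open import Algebra.Properties.CommutativeMonoid.Sum +-0-commutativeMonoid
  using (sum-syntax; sum-cong-≗; ∑-comm; ∑-distrib-+)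
open import Data.Fin using (Fin; zero; suc)
open import Data.List using (List; []; _∷_; _++_; map; concatMap; foldr; tabulate; allFin)
open import Data.List.Properties using (map-tabulate; map-concatMap; map-∘; concatMap-cong)
import Data.Vec.Functional as Vector
open import Data.Product using (_,_)
open import Function using (_∘_; id)
open import Relation.Binary.PropositionalEquality
  using (_≡_; refl; sym; trans; cong; cong₂; module ≡-Reasoning)
open import Relation.Nullary using (yes; no)

open ≡-Reasoning

sumℤ : List ℤ → ℤ
sumℤ = foldr _+_ 0ℤ

sumℤ-++ : ∀ xs ys → sumℤ (xs ++ ys) ≡ sumℤ xs + sumℤ ys
sumℤ-++ []       ys = sym (+-identityˡ (sumℤ ys))
sumℤ-++ (x ∷ xs) ys = trans (cong (_+_ x) (sumℤ-++ xs ys)) (sym (+-assoc x (sumℤ xs) (sumℤ ys)))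

sumℤ-concatMap : ∀ {A : Set} (F : A → List ℤ) xs →
                 sumℤ (concatMap F xs) ≡ sumℤ (map (sumℤ ∘ F) xs)
sumℤ-concatMap F []       = refl
sumℤ-concatMap F (x ∷ xs) =
  trans (sumℤ-++ (F x) (concatMap F xs)) (cong (_+_ (sumℤ (F x))) (sumℤ-concatMap F xs))

foldr-tabulate : ∀ {A B : Set} (_∙_ : A → B → B) (e : B) {n} (f : Fin n → A) →
                 foldr _∙_ e (tabulate f) ≡ Vector.foldr _∙_ e f
foldr-tabulate _∙_ e {zero}  f = refl
foldr-tabulate _∙_ e {suc n} f = cong (f zero ∙_) (foldr-tabulate _∙_ e (f ∘ suc))

sumℤ-allFin : ∀ {n} (f : Fin n → ℤ) → sumℤ (map f (allFin n)) ≡ ∑[ i < n ] f i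
sumℤ-allFin f = trans (cong sumℤ (map-tabulate id f)) (foldr-tabulate _+_ 0ℤ f)

entries : ∀ {A : Set} {m n} → (Fin m → Fin n → A) → List A
entries {m = m} {n} F = concatMap (λ i → map (F i) (allFin n)) (allFin m)

map-entries : ∀ {A B : Set} {m n} (g : A → B) (F : Fin m → Fin n → A) →
              map g (entries F) ≡ entries (λ i j → g (F i j))
map-entries {m = m} {n} g F = trans (map-concatMap g _ (allFin m))
  (concatMap-cong (λ i → sym (map-∘ (allFin n))) (allFin m))

sumℤ-entries : ∀ {m n} (F : Fin m → Fin n → ℤ) →
               sumℤ (entries F) ≡ ∑[ i < m ] ∑[ j < n ] F i j
sumℤ-entries {m} {n} F = begin
  sumℤ (entries F)                         ≡⟨ sumℤ-concatMap _ (allFin m) ⟩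
  sumℤ (map (sumℤ ∘ row-list) (allFin m))  ≡⟨ sumℤ-allFin (sumℤ ∘ row-list) ⟩
  ∑[ i < m ] sumℤ (row-list i)             ≡⟨ sum-cong-≗ (λ i → sumℤ-allFin (F i)) ⟩
  ∑[ i < m ] ∑[ j < n ] F i j              ∎
  where
  row-list : Fin m → List ℤ
  row-list i = map (F i) (allFin n)

sumℤ-map-entries : ∀ {A : Set} {m n} (g : A → ℤ) (F : Fin m → Fin n → A) →
                   sumℤ (map g (entries F)) ≡ ∑[ i < m ] ∑[ j < n ] g (F i j)
sumℤ-map-entries g F = trans (cong sumℤ (map-entries g F)) (sumℤ-entries (λ i j → g (F i j)))

∑∑-cong : ∀ {m n} {F G : Fin m → Fin n → ℤ} → (∀ i j → F i j ≡ G i j) →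
          ∑[ i < m ] ∑[ j < n ] F i j ≡ ∑[ i < m ] ∑[ j < n ] G i j
∑∑-cong F≡G = sum-cong-≗ (λ i → sum-cong-≗ (F≡G i))

∑-neg : ∀ {n} (f : Fin n → ℤ) → ∑[ i < n ] (- f i) ≡ - ∑[ i < n ] f i
∑-neg {zero}  f = refl
∑-neg {suc n} f = trans (cong (_+_ (- f zero)) (∑-neg (f ∘ suc)))
                        (sym (neg-distrib-+ (f zero) (∑[ i < n ] f (suc i))))

∑∑-neg : ∀ {m n} (F : Fin m → Fin n → ℤ) →
         ∑[ i < m ] ∑[ j < n ] (- F i j) ≡ - ∑[ i < m ] ∑[ j < n ] F i j
∑∑-neg {m} {n} F = trans (sum-cong-≗ (λ i → ∑-neg (F i))) (∑-neg (λ i → ∑[ j < n ] F i j))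

∑∑-distrib-+ : ∀ {m n} (F G : Fin m → Fin n → ℤ) →
               ∑[ i < m ] ∑[ j < n ] (F i j + G i j)
               ≡ ∑[ i < m ] ∑[ j < n ] F i j + ∑[ i < m ] ∑[ j < n ] G i j
∑∑-distrib-+ {m} {n} F G = trans (sum-cong-≗ (λ i → ∑-distrib-+ (F i) (G i)))
                                 (∑-distrib-+ (λ i → ∑[ j < n ] F i j) (λ i → ∑[ j < n ] G i j))

∑-one : ∀ n → ∑[ i < n ] 1ℤ ≡ + n
∑-one zero    = refl
∑-one (suc n) = cong (_+_ 1ℤ) (∑-one n)

sumℤ-nonzeros : ∀ L → sumℤ (nonzeros L) ≡ sumℤ L
sumℤ-nonzeros []       = refl
sumℤ-nonzeros (x ∷ xs) with x ℤ.≟ 0ℤ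
... | yes refl = trans (sumℤ-nonzeros xs) (sym (+-identityˡ (sumℤ xs)))
... | no _     = cong (_+_ x) (sumℤ-nonzeros xs)

AltPairs-sum : ∀ {a b} → a + b ≡ 0ℤ → ∀ {l} → AltPairs a b l → sumℤ l ≡ 0ℤ
AltPairs-sum a+b≡0 nil = refl
AltPairs-sum {a} {b} a+b≡0 (cons {l} p) = begin
  a + (b + sumℤ l) ≡⟨ cong (λ s → a + (b + s)) (AltPairs-sum a+b≡0 p) ⟩
  a + (b + 0ℤ)     ≡⟨ cong (_+_ a) (+-identityʳ b) ⟩
  a + b            ≡⟨ a+b≡0 ⟩
  0ℤ               ∎

sumℤ-leading : ∀ L {c l} → nonzeros L ≡ c ∷ l → sumℤ l ≡ 0ℤ → sumℤ L ≡ c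
sumℤ-leading L {c} {l} eq l≡0 = begin
  sumℤ L            ≡⟨ sym (sumℤ-nonzeros L) ⟩
  sumℤ (nonzeros L) ≡⟨ cong sumℤ eq ⟩
  c + sumℤ l        ≡⟨ cong (_+_ c) l≡0 ⟩
  c + 0ℤ            ≡⟨ +-identityʳ c ⟩
  c                 ∎

RowAlt-sum : ∀ L → RowAlt L → sumℤ L ≡ 1ℤ
RowAlt-sum L (l , eq , p) = sumℤ-leading L eq (AltPairs-sum refl p)

ColAlt-sum : ∀ L → ColAlt L → sumℤ L ≡ -1ℤ
ColAlt-sum L (l , eq , p) = sumℤ-leading L eq (AltPairs-sum refl p)

module _ {t n} {h v d : Mat n} (apm : IsAPM t n h v d) where
  open IsAPM apm

  ∑-row≡1 : ∀ i → ∑[ j < n ] h i j ≡ 1ℤ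
  ∑-row≡1 i = trans (sym (sumℤ-allFin (h i))) (RowAlt-sum (row h i) (rows i))

  ∑-col≡-1 : ∀ j → ∑[ i < n ] v i j ≡ -1ℤ
  ∑-col≡-1 j = trans (sym (sumℤ-allFin (λ i → v i j))) (ColAlt-sum (col v j) (cols j))

  ∑∑h≡n : ∑[ i < n ] ∑[ j < n ] h i j ≡ + n
  ∑∑h≡n = trans (sum-cong-≗ ∑-row≡1) (∑-one n)

  ∑∑v≡-n : ∑[ i < n ] ∑[ j < n ] v i j ≡ - + n
  ∑∑v≡-n = begin
    ∑[ i < n ] ∑[ j < n ] v i j  ≡⟨ ∑-comm v ⟩
    ∑[ j < n ] ∑[ i < n ] v i j  ≡⟨ sum-cong-≗ ∑-col≡-1 ⟩
    ∑[ j < n ] (- 1ℤ)            ≡⟨ ∑-neg {n} (λ _ → 1ℤ) ⟩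
    - ∑[ j < n ] 1ℤ              ≡⟨ cong -_ (∑-one n) ⟩
    - + n                        ∎

foldr-+E : ∀ xs → foldr _+E_ 0E xs ≡ mkE (sumℤ (map Eis.re xs)) (sumℤ (map Eis.om xs))
foldr-+E []       = refl
foldr-+E (x ∷ xs) = cong (x +E_) (foldr-+E xs)

-- solve-∀ does not unfold the Eis operations, hence the unfolded statements.
aEntry-re : ∀ x y → Eis.re (aEntry x y) ≡ - y
aEntry-re x y = unfolded x y
  where
  unfolded : ∀ x y → - (0ℤ ℤ.* x ℤ.- 1ℤ ℤ.* 0ℤ) + (-1ℤ ℤ.* y ℤ.- -1ℤ ℤ.* 0ℤ) ≡ - y
  unfolded = solve-∀

aEntry-om : ∀ x y → Eis.om (aEntry x y) ≡ - (x + y)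
aEntry-om x y = unfolded x y
  where
  unfolded : ∀ x y → - (0ℤ ℤ.* 0ℤ + 1ℤ ℤ.* x ℤ.- 1ℤ ℤ.* 0ℤ)
                     + (-1ℤ ℤ.* 0ℤ + -1ℤ ℤ.* y ℤ.- -1ℤ ℤ.* 0ℤ) ≡ - (x + y)
  unfolded = solve-∀

totalA-components : ∀ {n} (h v : Mat n) →
  totalA h v ≡ mkE (∑[ i < n ] ∑[ j < n ] (- v i j)) (∑[ i < n ] ∑[ j < n ] (- (h i j + v i j)))
totalA-components {n} h v = trans (foldr-+E (entries a)) (cong₂ mkE re-sum om-sum)
  where
  a : Fin n → Fin n → Eis
  a i j = aEntry (h i j) (v i j)
  re-sum : sumℤ (map Eis.re (entries a)) ≡ ∑[ i < n ] ∑[ j < n ] (- v i j)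
  re-sum = trans (sumℤ-map-entries Eis.re a) (∑∑-cong (λ i j → aEntry-re (h i j) (v i j)))
  om-sum : sumℤ (map Eis.om (entries a)) ≡ ∑[ i < n ] ∑[ j < n ] (- (h i j + v i j))
  om-sum = trans (sumℤ-map-entries Eis.om a) (∑∑-cong (λ i j → aEntry-om (h i j) (v i j)))

proposition7p4 : (t : APMType) (n : ℕ) → 1 ≤ n → (h v d : Mat n)
    → IsAPM t n h v d → totalA h v ≡ fromℤ (+ n)
proposition7p4 t n _ h v d apm = trans (totalA-components h v) (cong₂ mkE re≡n om≡0)
  where
  re≡n : ∑[ i < n ] ∑[ j < n ] (- v i j) ≡ + n
  re≡n = begin
    ∑[ i < n ] ∑[ j < n ] (- v i j)  ≡⟨ ∑∑-neg v ⟩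
    - ∑[ i < n ] ∑[ j < n ] v i j    ≡⟨ cong -_ (∑∑v≡-n apm) ⟩
    - - + n                          ≡⟨ neg-involutive (+ n) ⟩
    + n                              ∎

  om≡0 : ∑[ i < n ] ∑[ j < n ] (- (h i j + v i j)) ≡ 0ℤ
  om≡0 = begin
    ∑[ i < n ] ∑[ j < n ] (- (h i j + v i j))  ≡⟨ ∑∑-neg (λ i j → h i j + v i j) ⟩
    - ∑[ i < n ] ∑[ j < n ] (h i j + v i j)    ≡⟨ cong -_ (∑∑-distrib-+ h v) ⟩
    - (∑[ i < n ] ∑[ j < n ] h i j + ∑[ i < n ] ∑[ j < n ] v i j)
      ≡⟨ cong -_ (cong₂ _+_ (∑∑h≡n apm) (∑∑v≡-n apm)) ⟩
    - (+ n + - + n)                            ≡⟨ cong -_ (+-inverseʳ (+ n)) ⟩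
    0ℤ                                         ∎
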